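{- For $w,v\in\widehat{\mathfrak{H}}^{0}$, we have \begin{align*} w \mathbin{\sqcup\!\sqcup}_{q} v = \sigma (\sigma (w) \ast_{q} \sigma(v)). \end{align*}
   Context: Let $\hbar$ be a formal variable and $\mathcal{C}=\mathbb{Q}[\hbar,\hbar^{ -1}]$. Let $\widehat{\mathfrak{H}}=\mathcal{C}\langle a,b\rangle$, $\widehat{\mathfrak{H}}^0=\mathcal{C}+a\widehat{\mathfrak{H}}b$, and $e_k=a^kb$ for $k\ge0$. The $q$-stuffle product $\ast_q$ is the quasi-shuffle product on words in the letters $e_0,e_1,\dots$ given by $e_kw\ast_q e_lv=e_k(w\ast_q e_lv)+e_l(e_kw\ast_q v)+e_{k+l}(w\ast_q v)$ and ${\bf 1}\ast_q w=w\ast_q{\bf 1}=w$. The $q$-shuffle product $\mathbin{\sqcup\!\sqcup}_q$ is the $\mathcal{C}$-bilinear product on $\widehat{\mathfrak{H}}$ defined for letters $\alpha,\beta\in\{a,b\}$ and words $w,v$ by $\alpha w\mathbin{\sqcup\!\sqcup}_q\beta v=\alpha(w\mathbin{\sqcup\!\sqcup}_q\beta v)+\beta(\alpha w\mathbin{\sqcup\!\sqcup}_q v)+(\alpha\diamond_q\beta)(w\mathbin{\sqcup\!\sqcup}_q v)$, ${\bf 1}\mathbin{\sqcup\!\sqcup}_q w=w\mathbin{\sqcup\!\sqcup}_q{\bf 1}=w$, where $a\diamond_q b=b\diamond_q a=-ab$, $b\diamond_q b=-bb$, $a\diamond_q a=\hbar a$. $\sigma$ is the $\mathcal{C}$-linear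 anti-automorphism of $\widehat{\mathfrak{H}}$ with $\sigma(a)=\hbar b$, $\sigma(b)=\hbar^{ -1}a$, $\sigma({\bf 1})={\bf 1}$. -}

module Defs where

open import Data.Bool using (Bool; true; false; if_then_else_; _∧_)
open import Data.Nat using (ℕ; zero; suc) renaming (_+_ to _+ℕ_)
open import Data.Integer using (ℤ; 0ℤ; 1ℤ; -1ℤ) renaming (_+_ to _+ℤ_; _≟_ to _≟ℤ_)
open import Data.Rational using (ℚ; 0ℚ; 1ℚ) renaming (_+_ to _+ℚ_; _*_ to _*ℚ_; -_ to -ℚ_)
open import Data.List using (List; []; _∷_; _++_; map; concatMap; replicate; [_])
open import Data.List.Relation.Unary.All using (All)
open import Data.Maybe using (Maybe; just; nothing) renaming (map to mapMaybe)
open import Data.Product using (_×_; _,_; ∃)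
open import Data.Sum using (_⊎_)
open import Relation.Nullary using (Dec; yes; no)
open import Relation.Nullary.Decidable using (⌊_⌋)
open import Relation.Binary.PropositionalEquality using (_≡_; refl)
import Data.List.Properties as LP

data Letter : Set where
  a b : Letter

_≟L_ : (x y : Letter) → Dec (x ≡ y)
a ≟L a = yes refl
a ≟L b = no (λ ())
b ≟L a = no (λ ())
b ≟L b = yes refl

Word : Set
Word = List Letter

_≟W_ : (u v : Word) → Dec (u ≡ v)
_≟W_ = LP.≡-dec _≟L_

-- Elements of Ĥ over C = ℚ[ħ,ħ⁻¹]: formal finite sums of monomials
-- q ħ^n u   (q ∈ ℚ, n ∈ ℤ, u a word), encoded as (q , n , u).

Term : Set
Term = ℚ × ℤ × Word

Lin : Set
Lin = List Term

coeff : Lin → ℤ → Word → ℚ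
coeff [] n u = 0ℚ
coeff ((q , m , w) ∷ xs) n u =
  if ⌊ m ≟ℤ n ⌋ ∧ ⌊ w ≟W u ⌋ then q +ℚ coeff xs n u else coeff xs n u

infix 4 _≈_
_≈_ : Lin → Lin → Set
x ≈ y = ∀ n u → coeff x n u ≡ coeff y n u

scale : ℚ → ℤ → Lin → Lin
scale q n = map (λ { (q' , m , w) → (q *ℚ q' , n +ℤ m , w) })

pre : Letter → Lin → Lin
pre x = map (λ { (q , m , w) → (q , m , x ∷ w) })

diamond : Letter → Letter → Lin → Lin
diamond a a L = scale 1ℚ 1ℤ (pre a L)
diamond a b L = scale (-ℚ 1ℚ) 0ℤ (pre a (pre b L))
diamond b a L = scale (-ℚ 1ℚ) 0ℤ (pre a (pre b L))
diamond b b L = scale (-ℚ 1ℚ) 0ℤ (pre b (pre b L))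

shW : Word → Word → Lin
shW [] v = [ (1ℚ , 0ℤ , v) ]
shW (x ∷ w) [] = [ (1ℚ , 0ℤ , x ∷ w) ]
shW (α ∷ w) (β ∷ v) =
  pre α (shW w (β ∷ v)) ++ pre β (shW (α ∷ w) v) ++ diamond α β (shW w v)

bilinear : (Word → Word → Lin) → Lin → Lin → Lin
bilinear f L M =
  concatMap (λ { (q , m , w) →
    concatMap (λ { (q' , m' , v) → scale (q *ℚ q') (m +ℤ m') (f w v) }) M }) L

infixl 7 _⧢q_
_⧢q_ : Lin → Lin → Lin
_⧢q_ = bilinear shW

-- q-stuffle product on words in the letters e_k = a^k b

EWord : Set
EWord = List ℕ

ELin : Set
ELin = List (ℚ × ℤ × EWord)

epre : ℕ → ELin → ELin
epre k = map (λ { (q , m , w) → (q , m , k ∷ w) })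

stE : EWord → EWord → ELin
stE [] v = [ (1ℚ , 0ℤ , v) ]
stE (k ∷ w) [] = [ (1ℚ , 0ℤ , k ∷ w) ]
stE (k ∷ w) (l ∷ v) =
  epre k (stE w (l ∷ v)) ++ epre l (stE (k ∷ w) v) ++ epre (k +ℕ l) (stE w v)

fromE : EWord → Word
fromE [] = []
fromE (k ∷ w) = replicate k a ++ b ∷ fromE w

-- parse a word as a word in the e_k (possible iff it is empty or ends in b)
mutual
  toE : Word → Maybe EWord
  toE [] = just []
  toE (x ∷ u) = toE′ 0 (x ∷ u)

  toE′ : ℕ → Word → Maybe EWord
  toE′ k [] = nothing
  toE′ k (a ∷ u) = toE′ (suc k) u
  toE′ k (b ∷ u) = mapMaybe (k ∷_) (toE u)

-- ∗_q on words of Ĥ¹ = C + Ĥb (the span of words in the e_k);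
-- words not ending in b never occur in the statement
stW : Word → Word → Lin
stW w v with toE w | toE v
... | just w′ | just v′ = map (λ { (q , m , u) → (q , m , fromE u) }) (stE w′ v′)
... | _ | _ = []

infixl 7 _∗q_
_∗q_ : Lin → Lin → Lin
_∗q_ = bilinear stW

-- σ : C-linear anti-automorphism, σ(a) = ħ b, σ(b) = ħ⁻¹ a

σL : Letter → ℤ × Letter
σL a = (1ℤ , b)
σL b = (-1ℤ , a)

σW : Word → ℤ × Word
σW [] = (0ℤ , [])
σW (x ∷ u) with σW u | σL x
... | (n , u′) | (m , y) = (n +ℤ m , u′ ++ [ y ])

σ : Lin → Lin
σ = map (λ { (q , m , w) → let r = σW w in (q , m +ℤ Data.Product.proj₁ r , Data.Product.proj₂ r) })

InH0W : Word → Set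
InH0W w = w ≡ [] ⊎ ∃ (λ u → w ≡ a ∷ u ++ [ b ])

InH0 : Lin → Set
InH0 L = All (λ { (q , m , w) → InH0W w }) L

-- The q-shuffle is defined by a recursion on first letters, while σ reverses words, so
-- σ (σ w ∗_q σ v) obeys a recursion on last letters.  Two facts reconcile them.  First,
-- ⧢_q also satisfies the right-hand recursion
--   wα ⧢_q vβ = (w ⧢_q vβ) α + (wα ⧢_q v) β + (w ⧢_q v)(α ⋄_q β).
-- Second, on Ĥ¹ = C + Ĥb the q-stuffle, written in the letters a and b, satisfies
--   xu ∗_q yv = x (u ∗_q yv) + y (xu ∗_q v) + (x ⊙ y)(u ∗_q v)
-- with a ⊙ a = -aa, a ⊙ b = b ⊙ a = -ab, b ⊙ b = b, because e_k = a^k b and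
-- e_k ⋯ ∗ e_l ⋯ merges into e_(k+l) ⋯.  As σ is an anti-automorphism with
-- σ(x ⊙ y) = σ(x) ⋄_q σ(y), it turns the second recursion into the first.  Induction on the
-- lengths of w and v, with σ mapping C + aĤ onto Ĥ¹, gives the identity for single words,
-- and bilinearity extends it to Ĥ⁰.
module Submission where

open import Defs
open import Algebra.Bundles using (CommutativeMonoid)
open import Algebra.Structures using (IsCommutativeMonoid)
import Algebra.Solver.CommutativeMonoid as CommutativeMonoidSolver
open import Data.Empty using (⊥-elim)
open import Data.Nat using (ℕ; zero; suc) renaming (_+_ to _+ℕ_)
import Data.Nat.Properties as ℕ
open import Data.Integer using (ℤ; 0ℤ; 1ℤ) renaming (_+_ to _+ℤ_; _-_ to _-ℤ_; -_ to -ℤ_)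
import Data.Integer.Properties as ℤ
open import Data.Integer.Tactic.RingSolver using (solve-∀)
open import Data.List using (List; []; _∷_; _++_; _∷ʳ_; [_]; map; concatMap; drop; reverse; length)
import Data.List.Properties as List
open import Data.Maybe using (just) renaming (map to mapMaybe)
open import Data.Product using (_×_; _,_; proj₁; proj₂; ∃; ∃₂)
open import Data.Sum using (_⊎_; inj₁; inj₂)
open import Data.List.Reverse using (Reverse; []; _∶_∶ʳ_; reverseView)
open import Data.List.Relation.Unary.All using (All; []; _∷_)
open import Data.Product.Properties using (≡-dec)
open import Data.Rational using (ℚ; 0ℚ; 1ℚ) renaming (_+_ to _+ℚ_; _*_ to _*ℚ_; -_ to -ℚ_)
import Data.Rational.Properties as ℚ
open import Algebra.Properties.Ring ℚ.+-*-ring using (-1*x≈-x)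
open import Algebra.Properties.CommutativeSemigroup (CommutativeMonoid.commutativeSemigroup ℚ.*-1-commutativeMonoid)
  using () renaming (x∙yz≈y∙xz to ℚ-*-leftComm)
open import Algebra.Properties.CommutativeSemigroup ℤ.+-commutativeSemigroup
  using () renaming (x∙yz≈y∙xz to ℤ-+-leftComm; interchange to ℤ-+-interchange)
open import Function using (_∘_)
open import Relation.Binary.Bundles using (Setoid)
import Relation.Binary.Reasoning.Setoid
open import Relation.Binary.Definitions using (DecidableEquality)
open import Relation.Binary.PropositionalEquality
  using (_≡_; _≢_; refl; sym; trans; cong; cong₂; module ≡-Reasoning)
open import Relation.Nullary using (Dec; yes; no)

Monomial : Set
Monomial = ℤ × Word

_≟M_ : DecidableEquality Monomial
_≟M_ = ≡-dec ℤ._≟_ _≟W_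

coeffAt : Lin → Monomial → ℚ
coeffAt L (n , u) = coeff L n u

coeffAt-here : ∀ q x L → coeffAt ((q , x) ∷ L) x ≡ q +ℚ coeffAt L x
coeffAt-here q (m , w) L with m ℤ.≟ m | w ≟W w
... | yes _ | yes _ = refl
... | no m≢m | _ = ⊥-elim (m≢m refl)
... | yes _ | no w≢w = ⊥-elim (w≢w refl)

coeffAt-there : ∀ q {x y} L → x ≢ y → coeffAt ((q , x) ∷ L) y ≡ coeffAt L y
coeffAt-there q {m , w} {n , u} L x≢y with m ℤ.≟ n | w ≟W u
... | yes refl | yes refl = ⊥-elim (x≢y refl)
... | yes _ | no _ = refl
... | no _ | _ = refl

coeffAt-++ : ∀ L M x → coeffAt (L ++ M) x ≡ coeffAt L x +ℚ coeffAt M x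
coeffAt-++ [] M x = sym (ℚ.+-identityˡ _)
coeffAt-++ ((q , y) ∷ L) M x with y ≟M x
... | yes refl = begin
  coeffAt ((q , x) ∷ L ++ M) x             ≡⟨ coeffAt-here q x (L ++ M) ⟩
  q +ℚ coeffAt (L ++ M) x                  ≡⟨ cong (q +ℚ_) (coeffAt-++ L M x) ⟩
  q +ℚ (coeffAt L x +ℚ coeffAt M x)        ≡⟨ ℚ.+-assoc q _ _ ⟨
  (q +ℚ coeffAt L x) +ℚ coeffAt M x        ≡⟨ cong (_+ℚ coeffAt M x) (coeffAt-here q x L) ⟨
  coeffAt ((q , x) ∷ L) x +ℚ coeffAt M x   ∎
  where open ≡-Reasoning
... | no y≢x = begin
  coeffAt ((q , y) ∷ L ++ M) x             ≡⟨ coeffAt-there q (L ++ M) y≢x ⟩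
  coeffAt (L ++ M) x                       ≡⟨ coeffAt-++ L M x ⟩
  coeffAt L x +ℚ coeffAt M x               ≡⟨ cong (_+ℚ coeffAt M x) (coeffAt-there q L y≢x) ⟨
  coeffAt ((q , y) ∷ L) x +ℚ coeffAt M x   ∎
  where open ≡-Reasoning

-- A record rather than Defs' _≈_ itself, so that both sides can be inferred.
infix 4 _≋_
record _≋_ (L M : Lin) : Set where
  constructor coeffAt-≡⇒≋
  field coeffAt-≡ : ∀ x → coeffAt L x ≡ coeffAt M x
open _≋_

≋⇒≈ : ∀ {L M} → L ≋ M → L ≈ M
≋⇒≈ e n u = coeffAt-≡ e (n , u)

≡⇒≋ : ∀ {L M} → L ≡ M → L ≋ M
≡⇒≋ refl = coeffAt-≡⇒≋ λ _ → refl

≋-setoid : Setoid _ _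
≋-setoid = record
  { Carrier = Lin
  ; _≈_ = _≋_
  ; isEquivalence = record
    { refl = coeffAt-≡⇒≋ λ _ → refl
    ; sym = λ e → coeffAt-≡⇒≋ λ x → sym (coeffAt-≡ e x)
    ; trans = λ e f → coeffAt-≡⇒≋ λ x → trans (coeffAt-≡ e x) (coeffAt-≡ f x)
    }
  }

open Setoid ≋-setoid using () renaming (refl to ≋-refl)

++-cong : ∀ {L L′ M M′} → L ≋ L′ → M ≋ M′ → L ++ M ≋ L′ ++ M′
++-cong {L} {L′} {M} {M′} e f = coeffAt-≡⇒≋ λ x → begin
  coeffAt (L ++ M) x              ≡⟨ coeffAt-++ L M x ⟩
  coeffAt L x +ℚ coeffAt M x      ≡⟨ cong₂ _+ℚ_ (coeffAt-≡ e x) (coeffAt-≡ f x) ⟩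
  coeffAt L′ x +ℚ coeffAt M′ x    ≡⟨ coeffAt-++ L′ M′ x ⟨
  coeffAt (L′ ++ M′) x            ∎
  where open ≡-Reasoning

++-congʳ : ∀ {L L′} M → L ≋ L′ → L ++ M ≋ L′ ++ M
++-congʳ M e = ++-cong e ≋-refl

++-congˡ : ∀ L {M M′} → M ≋ M′ → L ++ M ≋ L ++ M′
++-congˡ L e = ++-cong ≋-refl e

++-comm : ∀ L M → L ++ M ≋ M ++ L
++-comm L M = coeffAt-≡⇒≋ λ x → begin
  coeffAt (L ++ M) x              ≡⟨ coeffAt-++ L M x ⟩
  coeffAt L x +ℚ coeffAt M x      ≡⟨ ℚ.+-comm (coeffAt L x) (coeffAt M x) ⟩
  coeffAt M x +ℚ coeffAt L x      ≡⟨ coeffAt-++ M L x ⟨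
  coeffAt (M ++ L) x              ∎
  where open ≡-Reasoning

++-isCommutativeMonoid : IsCommutativeMonoid _≋_ _++_ []
++-isCommutativeMonoid = record
  { isMonoid = record
    { isSemigroup = record
      { isMagma = record { isEquivalence = Setoid.isEquivalence ≋-setoid ; ∙-cong = ++-cong }
      ; assoc = λ L M N → ≡⇒≋ (List.++-assoc L M N)
      }
    ; identity = (λ _ → ≋-refl) , (λ L → ≡⇒≋ (List.++-identityʳ L))
    }
  ; comm = ++-comm
  }

++-commutativeMonoid : CommutativeMonoid _ _
++-commutativeMonoid = record { isCommutativeMonoid = ++-isCommutativeMonoid }

open CommutativeMonoidSolver ++-commutativeMonoid using (solve; _⊕_; _⊜_)

-- A termwise map (q , x) ↦ (φ q , F x) with F injective (witnessed by a retraction G)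
-- moves coefficients along F, so it respects ≋.
module TermMap (φ : ℚ → ℚ) (φ-+ : ∀ p q → φ (p +ℚ q) ≡ φ p +ℚ φ q) (φ-0 : φ 0ℚ ≡ 0ℚ)
               (F G : Monomial → Monomial) (G∘F : ∀ x → G (F x) ≡ x) where

  mapTerm : Term → Term
  mapTerm (q , x) = (φ q , F x)

  F-injective : ∀ {x y} → F x ≡ F y → x ≡ y
  F-injective {x} {y} Fx≡Fy = trans (sym (G∘F x)) (trans (cong G Fx≡Fy) (G∘F y))

  coeffAt-map-image : ∀ L x → coeffAt (map mapTerm L) (F x) ≡ φ (coeffAt L x)
  coeffAt-map-image [] x = sym φ-0
  coeffAt-map-image ((q , y) ∷ L) x with y ≟M x
  ... | yes refl = begin
    coeffAt ((φ q , F x) ∷ map mapTerm L) (F x)  ≡⟨ coeffAt-here (φ q) (F x) (map mapTerm L) ⟩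
    φ q +ℚ coeffAt (map mapTerm L) (F x)         ≡⟨ cong (φ q +ℚ_) (coeffAt-map-image L x) ⟩
    φ q +ℚ φ (coeffAt L x)                       ≡⟨ φ-+ q (coeffAt L x) ⟨
    φ (q +ℚ coeffAt L x)                         ≡⟨ cong φ (coeffAt-here q x L) ⟨
    φ (coeffAt ((q , x) ∷ L) x)                  ∎
    where open ≡-Reasoning
  ... | no y≢x = begin
    coeffAt ((φ q , F y) ∷ map mapTerm L) (F x)  ≡⟨ coeffAt-there (φ q) (map mapTerm L) (y≢x ∘ F-injective) ⟩
    coeffAt (map mapTerm L) (F x)                ≡⟨ coeffAt-map-image L x ⟩
    φ (coeffAt L x)                              ≡⟨ cong φ (coeffAt-there q L y≢x) ⟨
    φ (coeffAt ((q , y) ∷ L) x)                  ∎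
    where open ≡-Reasoning

  coeffAt-map-nonimage : ∀ L y → (∀ x → F x ≢ y) → coeffAt (map mapTerm L) y ≡ 0ℚ
  coeffAt-map-nonimage [] y y∉F = refl
  coeffAt-map-nonimage ((q , x) ∷ L) y y∉F =
    trans (coeffAt-there (φ q) (map mapTerm L) (y∉F x)) (coeffAt-map-nonimage L y y∉F)

  map-cong : ∀ {L M} → L ≋ M → map mapTerm L ≋ map mapTerm M
  map-cong {L} {M} L≋M = coeffAt-≡⇒≋ λ y → coeffAt-map-≡ y (F (G y) ≟M y)
    where
    coeffAt-map-≡ : ∀ y → Dec (F (G y) ≡ y) → coeffAt (map mapTerm L) y ≡ coeffAt (map mapTerm M) y
    coeffAt-map-≡ y (yes FGy≡y) = begin
      coeffAt (map mapTerm L) y        ≡⟨ cong (coeffAt (map mapTerm L)) FGy≡y ⟨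
      coeffAt (map mapTerm L) (F (G y)) ≡⟨ coeffAt-map-image L (G y) ⟩
      φ (coeffAt L (G y))              ≡⟨ cong φ (coeffAt-≡ L≋M (G y)) ⟩
      φ (coeffAt M (G y))              ≡⟨ coeffAt-map-image M (G y) ⟨
      coeffAt (map mapTerm M) (F (G y)) ≡⟨ cong (coeffAt (map mapTerm M)) FGy≡y ⟩
      coeffAt (map mapTerm M) y        ∎
      where open ≡-Reasoning
    coeffAt-map-≡ y (no FGy≢y) = trans (coeffAt-map-nonimage L y y∉F) (sym (coeffAt-map-nonimage M y y∉F))
      where
      y∉F : ∀ x → F x ≢ y
      y∉F x Fx≡y = FGy≢y (trans (cong (F ∘ G) (sym Fx≡y)) (trans (cong F (G∘F x)) Fx≡y))

dropSuffix : ℕ → Word → Word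
dropSuffix n = reverse ∘ drop n ∘ reverse

dropSuffix-++ : ∀ w S → dropSuffix (length S) (w ++ S) ≡ w
dropSuffix-++ w S = begin
  reverse (drop (length S) (reverse (w ++ S)))               ≡⟨ cong (reverse ∘ drop (length S)) (List.reverse-++ w S) ⟩
  reverse (drop (length S) (reverse S ++ reverse w))         ≡⟨ cong (λ n → reverse (drop n (reverse S ++ reverse w))) (List.length-reverse S) ⟨
  reverse (drop (length (reverse S)) (reverse S ++ reverse w)) ≡⟨ cong reverse (drop-length-++ (reverse S) (reverse w)) ⟩
  reverse (reverse w)                                         ≡⟨ List.reverse-involutive w ⟩
  w                                                           ∎
  where
  open ≡-Reasoning
  drop-length-++ : ∀ (u v : Word) → drop (length u) (u ++ v) ≡ v
  drop-length-++ [] v = refl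
  drop-length-++ (_ ∷ u) v = drop-length-++ u v

pre-cong : ∀ x {L M} → L ≋ M → pre x L ≋ pre x M
pre-cong x = TermMap.map-cong (λ q → q) (λ _ _ → refl) refl
  (λ (m , w) → (m , x ∷ w)) (λ (n , u) → (n , drop 1 u)) (λ _ → refl)

post : Letter → Lin → Lin
post x = map (λ { (q , m , w) → (q , m , w ∷ʳ x) })

post-cong : ∀ x {L M} → L ≋ M → post x L ≋ post x M
post-cong x = TermMap.map-cong (λ q → q) (λ _ _ → refl) refl
  (λ (m , w) → (m , w ∷ʳ x)) (λ (n , u) → (n , dropSuffix 1 u)) (λ (m , w) → cong (m ,_) (dropSuffix-++ w [ x ]))

minus-plus : ∀ k m → (k +ℤ m) -ℤ k ≡ m
minus-plus = solve-∀

module ScaleMap (c : ℚ) (k : ℤ) = TermMap (c *ℚ_) (ℚ.*-distribˡ-+ c) (ℚ.*-zeroʳ c)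
  (λ (m , w) → (k +ℤ m , w)) (λ (n , u) → (n -ℤ k , u)) (λ (m , w) → cong (_, w) (minus-plus k m))

scale-cong : ∀ c k {L M} → L ≋ M → scale c k L ≋ scale c k M
scale-cong = ScaleMap.map-cong

neg : Lin → Lin
neg = scale (-ℚ 1ℚ) 0ℤ

coeffAt-neg : ∀ L n u → coeffAt (neg L) (n , u) ≡ -ℚ coeffAt L (n , u)
coeffAt-neg L n u = begin
  coeffAt (neg L) (n , u)          ≡⟨ cong (λ j → coeffAt (neg L) (j , u)) (ℤ.+-identityˡ n) ⟨
  coeffAt (neg L) (0ℤ +ℤ n , u)    ≡⟨ ScaleMap.coeffAt-map-image (-ℚ 1ℚ) 0ℤ L (n , u) ⟩
  -ℚ 1ℚ *ℚ coeffAt L (n , u)       ≡⟨ -1*x≈-x (coeffAt L (n , u)) ⟩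
  -ℚ coeffAt L (n , u)             ∎
  where open ≡-Reasoning

++-neg-cancelʳ : ∀ L P → (L ++ P) ++ neg P ≋ L
++-neg-cancelʳ L P = coeffAt-≡⇒≋ λ (n , u) → begin
  coeffAt ((L ++ P) ++ neg P) (n , u)                         ≡⟨ coeffAt-++ (L ++ P) (neg P) (n , u) ⟩
  coeffAt (L ++ P) (n , u) +ℚ coeffAt (neg P) (n , u)         ≡⟨ cong₂ _+ℚ_ (coeffAt-++ L P (n , u)) (coeffAt-neg P n u) ⟩
  (coeffAt L (n , u) +ℚ coeffAt P (n , u)) +ℚ -ℚ coeffAt P (n , u)
                                                             ≡⟨ ℚ.+-assoc (coeffAt L (n , u)) _ _ ⟩
  coeffAt L (n , u) +ℚ (coeffAt P (n , u) +ℚ -ℚ coeffAt P (n , u))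
                                                             ≡⟨ cong (coeffAt L (n , u) +ℚ_) (ℚ.+-inverseʳ (coeffAt P (n , u))) ⟩
  coeffAt L (n , u) +ℚ 0ℚ                                    ≡⟨ ℚ.+-identityʳ _ ⟩
  coeffAt L (n , u)                                          ∎
  where open ≡-Reasoning

shift : ℤ → Lin → Lin
shift k = map (λ { (q , m , w) → (q , k +ℤ m , w) })

shift-cong : ∀ k {L M} → L ≋ M → shift k L ≋ shift k M
shift-cong k = TermMap.map-cong (λ q → q) (λ _ _ → refl) refl
  (λ (m , w) → (k +ℤ m , w)) (λ (n , u) → (n -ℤ k , u)) (λ (m , w) → cong (_, w) (minus-plus k m))

swap : Letter → Letter
swap x = proj₂ (σL x)

weight : Letter → ℤ
weight x = proj₁ (σL x)

exponent : Word → ℤ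
exponent w = proj₁ (σW w)

mirror : Word → Word
mirror w = proj₂ (σW w)

swap-involutive : ∀ x → swap (swap x) ≡ x
swap-involutive a = refl
swap-involutive b = refl

weight-swap : ∀ x → weight (swap x) ≡ -ℤ weight x
weight-swap a = refl
weight-swap b = refl

mirror-∷ʳ : ∀ u x → mirror (u ∷ʳ x) ≡ swap x ∷ mirror u
mirror-∷ʳ [] x = refl
mirror-∷ʳ (y ∷ u) x = cong (_∷ʳ swap y) (mirror-∷ʳ u x)

exponent-∷ʳ : ∀ u x → exponent (u ∷ʳ x) ≡ exponent u +ℤ weight x
exponent-∷ʳ [] x = refl
exponent-∷ʳ (y ∷ u) x = trans (cong (_+ℤ weight y) (exponent-∷ʳ u x)) (comm-right (exponent u) (weight x) (weight y))
  where
  comm-right : ∀ i j k → (i +ℤ j) +ℤ k ≡ (i +ℤ k) +ℤ j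
  comm-right = solve-∀

mirror-involutive : ∀ u → mirror (mirror u) ≡ u
mirror-involutive [] = refl
mirror-involutive (x ∷ u) =
  trans (mirror-∷ʳ (mirror u) (swap x)) (cong₂ _∷_ (swap-involutive x) (mirror-involutive u))

exponent-mirror : ∀ u → exponent (mirror u) ≡ -ℤ exponent u
exponent-mirror [] = refl
exponent-mirror (x ∷ u) = begin
  exponent (mirror u ∷ʳ swap x)                 ≡⟨ exponent-∷ʳ (mirror u) (swap x) ⟩
  exponent (mirror u) +ℤ weight (swap x)        ≡⟨ cong₂ _+ℤ_ (exponent-mirror u) (weight-swap x) ⟩
  -ℤ exponent u +ℤ -ℤ weight x                  ≡⟨ ℤ.neg-distrib-+ (exponent u) (weight x) ⟨
  -ℤ (exponent u +ℤ weight x)                   ∎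
  where open ≡-Reasoning

σTerm : Term → Term
σTerm (q , m , w) = (q , m +ℤ exponent w , mirror w)

σ-cong : ∀ {L M} → L ≋ M → σ L ≋ σ M
σ-cong = TermMap.map-cong (λ q → q) (λ _ _ → refl) refl
  (λ (m , w) → (m +ℤ exponent w , mirror w)) (λ (n , u) → (n +ℤ exponent u , mirror u))
  (λ (m , w) → cong₂ _,_ (trans (cong (m +ℤ exponent w +ℤ_) (exponent-mirror w)) (plus-minus m (exponent w)))
                         (mirror-involutive w))
  where
  plus-minus : ∀ m e → (m +ℤ e) +ℤ -ℤ e ≡ m
  plus-minus = solve-∀

infixr 6 _·_
infixl 6 _·ʳ_

_·_ : Term → Lin → Lin
(c , k , P) · L = map (λ { (q , m , w) → (c *ℚ q , k +ℤ m , P ++ w) }) L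

_·ʳ_ : Lin → Term → Lin
L ·ʳ (c , k , S) = map (λ { (q , m , w) → (c *ℚ q , k +ℤ m , w ++ S) }) L

_⋄_ : Letter → Letter → Term
a ⋄ a = (1ℚ , 1ℤ , a ∷ [])
a ⋄ b = (-ℚ 1ℚ , 0ℤ , a ∷ b ∷ [])
b ⋄ a = (-ℚ 1ℚ , 0ℤ , a ∷ b ∷ [])
b ⋄ b = (-ℚ 1ℚ , 0ℤ , b ∷ b ∷ [])

·ʳ-cong : ∀ t {L M} → L ≋ M → L ·ʳ t ≋ M ·ʳ t
·ʳ-cong (c , k , S) = TermMap.map-cong (c *ℚ_) (ℚ.*-distribˡ-+ c) (ℚ.*-zeroʳ c)
  (λ (m , w) → (k +ℤ m , w ++ S)) (λ (n , u) → (n -ℤ k , dropSuffix (length S) u))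
  (λ (m , w) → cong₂ _,_ (minus-plus k m) (dropSuffix-++ w S))

diamond-· : ∀ x y L → diamond x y L ≡ (x ⋄ y) · L
diamond-· a a L = sym (List.map-∘ L)
diamond-· a b L = trans (sym (List.map-∘ (map _ L))) (sym (List.map-∘ L))
diamond-· b a L = trans (sym (List.map-∘ (map _ L))) (sym (List.map-∘ L))
diamond-· b b L = trans (sym (List.map-∘ (map _ L))) (sym (List.map-∘ L))

·-·ʳ-comm : ∀ s t L → s · (L ·ʳ t) ≡ (s · L) ·ʳ t
·-·ʳ-comm s t [] = refl
·-·ʳ-comm s@(c , k , P) t@(c′ , k′ , S) ((q , m , w) ∷ L) =
  cong₂ _∷_ (cong₂ _,_ (ℚ-*-leftComm c c′ q) (cong₂ _,_ (ℤ-+-leftComm k k′ m) (sym (List.++-assoc P w S))))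
            (·-·ʳ-comm s t L)

pre-·ʳ-comm : ∀ x t L → pre x (L ·ʳ t) ≡ pre x L ·ʳ t
pre-·ʳ-comm x t [] = refl
pre-·ʳ-comm x t (_ ∷ L) = cong (_ ∷_) (pre-·ʳ-comm x t L)

pre-post-comm : ∀ x α L → pre x (post α L) ≡ post α (pre x L)
pre-post-comm x α [] = refl
pre-post-comm x α (_ ∷ L) = cong (_ ∷_) (pre-post-comm x α L)

·-post-comm : ∀ s α L → s · post α L ≡ post α (s · L)
·-post-comm s α [] = refl
·-post-comm s@(c , k , P) α ((q , m , w) ∷ L) =
  cong₂ _∷_ (cong (λ u → c *ℚ q , k +ℤ m , u) (sym (List.++-assoc P w [ α ]))) (·-post-comm s α L)

map-++₃ : ∀ {A B : Set} (f : A → B) L M N → map f (L ++ M ++ N) ≡ map f L ++ map f M ++ map f N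
map-++₃ f L M N = trans (List.map-++ f L (M ++ N)) (cong (map f L ++_) (List.map-++ f M N))

diamond-cong : ∀ x y {L M} → L ≋ M → diamond x y L ≋ diamond x y M
diamond-cong a a e = scale-cong 1ℚ 1ℤ (pre-cong a e)
diamond-cong a b e = scale-cong (-ℚ 1ℚ) 0ℤ (pre-cong a (pre-cong b e))
diamond-cong b a e = scale-cong (-ℚ 1ℚ) 0ℤ (pre-cong a (pre-cong b e))
diamond-cong b b e = scale-cong (-ℚ 1ℚ) 0ℤ (pre-cong b (pre-cong b e))

⟦_⟧ : Word → Lin
⟦ w ⟧ = [ (1ℚ , 0ℤ , w) ]

diamondʳ : Letter → Letter → Lin → Lin
diamondʳ α β L = L ·ʳ (α ⋄ β)

diamond-⟦[]⟧ : ∀ x y → diamond x y ⟦ [] ⟧ ≡ diamondʳ x y ⟦ [] ⟧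
diamond-⟦[]⟧ a a = refl
diamond-⟦[]⟧ a b = refl
diamond-⟦[]⟧ b a = refl
diamond-⟦[]⟧ b b = refl

diamond-post-comm : ∀ x y α L → diamond x y (post α L) ≡ post α (diamond x y L)
diamond-post-comm x y α L = begin
  diamond x y (post α L)    ≡⟨ diamond-· x y (post α L) ⟩
  (x ⋄ y) · post α L        ≡⟨ ·-post-comm (x ⋄ y) α L ⟩
  post α ((x ⋄ y) · L)      ≡⟨ cong (post α) (diamond-· x y L) ⟨
  post α (diamond x y L)    ∎
  where open ≡-Reasoning

shW-[]ʳ : ∀ w → shW w [] ≡ ⟦ w ⟧
shW-[]ʳ [] = refl
shW-[]ʳ (x ∷ w) = refl

shuffleʳ : Letter → Letter → Lin → Lin → Lin → Lin
shuffleʳ α β P Q R = post α P ++ post β Q ++ diamondʳ α β R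

shuffleʳ-cong : ∀ α β {P P′ Q Q′ R R′} → P ≋ P′ → Q ≋ Q′ → R ≋ R′ →
                shuffleʳ α β P Q R ≋ shuffleʳ α β P′ Q′ R′
shuffleʳ-cong α β P≋P′ Q≋Q′ R≋R′ =
  ++-cong (post-cong α P≋P′) (++-cong (post-cong β Q≋Q′) (·ʳ-cong (α ⋄ β) R≋R′))

shuffleʳ-natural : ∀ (F : Lin → Lin) → (∀ L M → F (L ++ M) ≡ F L ++ F M) →
                   (∀ α L → F (post α L) ≡ post α (F L)) → (∀ t L → F (L ·ʳ t) ≡ F L ·ʳ t) →
                   ∀ α β P Q R → F (shuffleʳ α β P Q R) ≡ shuffleʳ α β (F P) (F Q) (F R)
shuffleʳ-natural F F-++ F-post F-·ʳ α β P Q R =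
  trans (F-++ (post α P) _) (cong₂ _++_ (F-post α P)
    (trans (F-++ (post β Q) _) (cong₂ _++_ (F-post β Q) (F-·ʳ (α ⋄ β) R))))

pre-shuffleʳ : ∀ x α β P Q R → pre x (shuffleʳ α β P Q R) ≡ shuffleʳ α β (pre x P) (pre x Q) (pre x R)
pre-shuffleʳ x = shuffleʳ-natural (pre x) (List.map-++ _) (pre-post-comm x) (pre-·ʳ-comm x)

diamond-shuffleʳ : ∀ x y α β P Q R →
                   diamond x y (shuffleʳ α β P Q R) ≡ shuffleʳ α β (diamond x y P) (diamond x y Q) (diamond x y R)
diamond-shuffleʳ x y = shuffleʳ-natural (diamond x y)
  (λ L M → trans (diamond-· x y (L ++ M)) (trans (List.map-++ _ L M) (sym (cong₂ _++_ (diamond-· x y L) (diamond-· x y M)))))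
  (diamond-post-comm x y)
  (λ t L → trans (diamond-· x y (L ·ʳ t)) (trans (·-·ʳ-comm (x ⋄ y) t L) (cong (_·ʳ t) (sym (diamond-· x y L)))))

module ≋-Reasoning = Relation.Binary.Reasoning.Setoid ≋-setoid

shW-∷ʳ : ∀ α β w v → shW (w ∷ʳ α) (v ∷ʳ β) ≋ shuffleʳ α β (shW w (v ∷ʳ β)) (shW (w ∷ʳ α) v) (shW w v)
shW-∷ʳ α β [] [] = begin
  X ++ Y ++ diamond α β ⟦ [] ⟧   ≡⟨ cong (λ D → X ++ Y ++ D) (diamond-⟦[]⟧ α β) ⟩
  X ++ Y ++ D                    ≈⟨ solve 3 (λ X Y D → X ⊕ Y ⊕ D ⊜ Y ⊕ X ⊕ D) ≋-refl X Y D ⟩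
  Y ++ X ++ D                    ∎
  where
  open ≋-Reasoning
  X = ⟦ α ∷ β ∷ [] ⟧
  Y = ⟦ β ∷ α ∷ [] ⟧
  D = diamondʳ α β ⟦ [] ⟧
shW-∷ʳ α β [] (y ∷ v) = begin
  X ++ pre y (shW [ α ] (v ∷ʳ β)) ++ diamond α y (post β ⟦ v ⟧)
    ≈⟨ ++-congˡ X (++-congʳ (diamond α y (post β ⟦ v ⟧)) (pre-cong y (shW-∷ʳ α β [] v))) ⟩
  X ++ pre y (shuffleʳ α β ⟦ v ∷ʳ β ⟧ (shW [ α ] v) ⟦ v ⟧) ++ diamond α y (post β ⟦ v ⟧)
    ≡⟨ cong₂ (λ S D → X ++ S ++ D) (pre-shuffleʳ y α β ⟦ v ∷ʳ β ⟧ (shW [ α ] v) ⟦ v ⟧) (diamond-post-comm α y β ⟦ v ⟧) ⟩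
  X ++ (A ++ B ++ C) ++ Z
    ≈⟨ solve 5 (λ X A B C Z → X ⊕ (A ⊕ B ⊕ C) ⊕ Z ⊜ A ⊕ (X ⊕ B ⊕ Z) ⊕ C) ≋-refl X A B C Z ⟩
  A ++ (X ++ B ++ Z) ++ C
    ≡⟨ cong (λ S → A ++ S ++ C) (map-++₃ _ ⟦ α ∷ y ∷ v ⟧ (pre y (shW [ α ] v)) (diamond α y ⟦ v ⟧)) ⟨
  shuffleʳ α β (shW [] (y ∷ v ∷ʳ β)) (shW [ α ] (y ∷ v)) (shW [] (y ∷ v))  ∎
  where
  open ≋-Reasoning
  X = post β ⟦ α ∷ y ∷ v ⟧
  A = post α ⟦ y ∷ v ∷ʳ β ⟧
  B = post β (pre y (shW [ α ] v))
  C = diamondʳ α β ⟦ y ∷ v ⟧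
  Z = post β (diamond α y ⟦ v ⟧)
shW-∷ʳ α β (x ∷ w) [] = begin
  pre x (shW (w ∷ʳ α) [ β ]) ++ P ++ diamond x β (shW (w ∷ʳ α) [])
    ≈⟨ ++-congʳ (P ++ diamond x β (shW (w ∷ʳ α) [])) (pre-cong x (shW-∷ʳ α β w [])) ⟩
  pre x (shuffleʳ α β (shW w [ β ]) (shW (w ∷ʳ α) []) (shW w [])) ++ P ++ diamond x β (shW (w ∷ʳ α) [])
    ≡⟨ cong (_++ P ++ diamond x β (shW (w ∷ʳ α) [])) (pre-shuffleʳ x α β (shW w [ β ]) (shW (w ∷ʳ α) []) (shW w [])) ⟩
  shuffleʳ α β A (pre x (shW (w ∷ʳ α) [])) (pre x (shW w [])) ++ P ++ diamond x β (shW (w ∷ʳ α) [])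
    ≡⟨ cong₂ (λ L M → shuffleʳ α β A (pre x L) (pre x M) ++ P ++ diamond x β L) (shW-[]ʳ (w ∷ʳ α)) (shW-[]ʳ w) ⟩
  (post α A ++ B ++ C) ++ P ++ diamond x β (post α ⟦ w ⟧)
    ≡⟨ cong (λ D → (post α A ++ B ++ C) ++ P ++ D) (diamond-post-comm x β α ⟦ w ⟧) ⟩
  (post α A ++ B ++ C) ++ P ++ Z
    ≈⟨ solve 5 (λ A B C P Z → (A ⊕ B ⊕ C) ⊕ P ⊕ Z ⊜ (A ⊕ P ⊕ Z) ⊕ B ⊕ C) ≋-refl (post α A) B C P Z ⟩
  (post α A ++ P ++ Z) ++ B ++ C
    ≡⟨ cong (_++ B ++ C) (map-++₃ _ A (pre β ⟦ x ∷ w ⟧) (diamond x β ⟦ w ⟧)) ⟨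
  post α (A ++ pre β ⟦ x ∷ w ⟧ ++ diamond x β ⟦ w ⟧) ++ B ++ C
    ≡⟨ cong (λ L → post α (A ++ pre β ⟦ x ∷ w ⟧ ++ diamond x β L) ++ B ++ C) (shW-[]ʳ w) ⟨
  shuffleʳ α β (shW (x ∷ w) [ β ]) (shW (x ∷ w ∷ʳ α) []) (shW (x ∷ w) [])  ∎
  where
  open ≋-Reasoning
  A = pre x (shW w [ β ])
  B = post β ⟦ x ∷ w ∷ʳ α ⟧
  C = diamondʳ α β ⟦ x ∷ w ⟧
  P = post α (pre β ⟦ x ∷ w ⟧)
  Z = post α (diamond x β ⟦ w ⟧)
shW-∷ʳ α β (x ∷ w) (y ∷ v) = begin
  pre x (shW (w ∷ʳ α) (y ∷ v ∷ʳ β)) ++ pre y (shW (x ∷ w ∷ʳ α) (v ∷ʳ β)) ++ diamond x y (shW (w ∷ʳ α) (v ∷ʳ β))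
    ≈⟨ ++-cong (pre-cong x (shW-∷ʳ α β w (y ∷ v)))
               (++-cong (pre-cong y (shW-∷ʳ α β (x ∷ w) v)) (diamond-cong x y (shW-∷ʳ α β w v))) ⟩
  pre x (shuffleʳ α β P₁ Q₁ R₁) ++ pre y (shuffleʳ α β P₂ Q₂ R₂) ++ diamond x y (shuffleʳ α β P₃ Q₃ R₃)
    ≡⟨ cong₂ _++_ (pre-shuffleʳ x α β P₁ Q₁ R₁)
                  (cong₂ _++_ (pre-shuffleʳ y α β P₂ Q₂ R₂) (diamond-shuffleʳ x y α β P₃ Q₃ R₃)) ⟩
  (a₁ ++ b₁ ++ c₁) ++ (a₂ ++ b₂ ++ c₂) ++ (a₃ ++ b₃ ++ c₃)
    ≈⟨ solve 9 (λ a₁ b₁ c₁ a₂ b₂ c₂ a₃ b₃ c₃ →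
                  (a₁ ⊕ b₁ ⊕ c₁) ⊕ (a₂ ⊕ b₂ ⊕ c₂) ⊕ (a₃ ⊕ b₃ ⊕ c₃) ⊜ (a₁ ⊕ a₂ ⊕ a₃) ⊕ (b₁ ⊕ b₂ ⊕ b₃) ⊕ (c₁ ⊕ c₂ ⊕ c₃))
               ≋-refl a₁ b₁ c₁ a₂ b₂ c₂ a₃ b₃ c₃ ⟩
  (a₁ ++ a₂ ++ a₃) ++ (b₁ ++ b₂ ++ b₃) ++ (c₁ ++ c₂ ++ c₃)
    ≡⟨ cong₂ _++_ (map-++₃ _ (pre x P₁) (pre y P₂) (diamond x y P₃))
                  (cong₂ _++_ (map-++₃ _ (pre x Q₁) (pre y Q₂) (diamond x y Q₃))
                              (map-++₃ _ (pre x R₁) (pre y R₂) (diamond x y R₃))) ⟨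
  shuffleʳ α β (shW (x ∷ w) (y ∷ v ∷ʳ β)) (shW (x ∷ w ∷ʳ α) (y ∷ v)) (shW (x ∷ w) (y ∷ v))  ∎
  where
  open ≋-Reasoning
  P₁ = shW w (y ∷ v ∷ʳ β)
  Q₁ = shW (w ∷ʳ α) (y ∷ v)
  R₁ = shW w (y ∷ v)
  P₂ = shW (x ∷ w) (v ∷ʳ β)
  Q₂ = shW (x ∷ w ∷ʳ α) v
  R₂ = shW (x ∷ w) v
  P₃ = shW w (v ∷ʳ β)
  Q₃ = shW (w ∷ʳ α) v
  R₃ = shW w v
  a₁ = post α (pre x P₁)
  b₁ = post β (pre x Q₁)
  c₁ = diamondʳ α β (pre x R₁)
  a₂ = post α (pre y P₂)
  b₂ = post β (pre y Q₂)
  c₂ = diamondʳ α β (pre y R₂)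
  a₃ = post α (diamond x y P₃)
  b₃ = post β (diamond x y Q₃)
  c₃ = diamondʳ α β (diamond x y R₃)

InĤ¹ : Word → Set
InĤ¹ u = ∃ λ E → fromE E ≡ u

toE′-fromE : ∀ n k E → toE′ n (fromE (k ∷ E)) ≡ mapMaybe ((n +ℕ k) ∷_) (toE (fromE E))
toE′-fromE n zero E = cong (λ j → mapMaybe (j ∷_) (toE (fromE E))) (sym (ℕ.+-identityʳ n))
toE′-fromE n (suc k) E = trans (toE′-fromE (suc n) k E) (cong (λ j → mapMaybe (j ∷_) (toE (fromE E))) (sym (ℕ.+-suc n k)))

toE-fromE : ∀ E → toE (fromE E) ≡ just E
toE-fromE [] = refl
toE-fromE (zero ∷ E) = cong (mapMaybe (0 ∷_)) (toE-fromE E)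
toE-fromE (suc k ∷ E) = trans (toE′-fromE 1 k E) (cong (mapMaybe (suc k ∷_)) (toE-fromE E))

fromELin : ELin → Lin
fromELin = map (λ { (q , m , u) → (q , m , fromE u) })

stW-fromE : ∀ E F → stW (fromE E) (fromE F) ≡ fromELin (stE E F)
stW-fromE E F with toE (fromE E) | toE-fromE E | toE (fromE F) | toE-fromE F
... | _ | refl | _ | refl = refl

ePrefix : ℕ → Lin → Lin
ePrefix zero = pre b
ePrefix (suc k) = pre a ∘ ePrefix k

fromELin-epre : ∀ k L → fromELin (epre k L) ≡ ePrefix k (fromELin L)
fromELin-epre zero [] = refl
fromELin-epre zero (_ ∷ L) = cong (_ ∷_) (fromELin-epre zero L)
fromELin-epre (suc k) L = trans (fromELin-epre-suc L) (cong (pre a) (fromELin-epre k L))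
  where
  fromELin-epre-suc : ∀ L → fromELin (epre (suc k) L) ≡ pre a (fromELin (epre k L))
  fromELin-epre-suc [] = refl
  fromELin-epre-suc (_ ∷ L) = cong (_ ∷_) (fromELin-epre-suc L)

stW-fromE-∷ : ∀ k l E F → stW (fromE (k ∷ E)) (fromE (l ∷ F)) ≡
              ePrefix k (stW (fromE E) (fromE (l ∷ F))) ++ ePrefix l (stW (fromE (k ∷ E)) (fromE F))
                ++ ePrefix (k +ℕ l) (stW (fromE E) (fromE F))
stW-fromE-∷ k l E F = begin
  stW (fromE (k ∷ E)) (fromE (l ∷ F))
    ≡⟨ stW-fromE (k ∷ E) (l ∷ F) ⟩
  fromELin (epre k (stE E (l ∷ F)) ++ epre l (stE (k ∷ E) F) ++ epre (k +ℕ l) (stE E F))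
    ≡⟨ map-++₃ _ (epre k (stE E (l ∷ F))) (epre l (stE (k ∷ E) F)) (epre (k +ℕ l) (stE E F)) ⟩
  fromELin (epre k (stE E (l ∷ F))) ++ fromELin (epre l (stE (k ∷ E) F)) ++ fromELin (epre (k +ℕ l) (stE E F))
    ≡⟨ cong₂ _++_ (fromELin-epre k _) (cong₂ _++_ (fromELin-epre l _) (fromELin-epre (k +ℕ l) _)) ⟩
  ePrefix k (fromELin (stE E (l ∷ F))) ++ ePrefix l (fromELin (stE (k ∷ E) F)) ++ ePrefix (k +ℕ l) (fromELin (stE E F))
    ≡⟨ cong₂ _++_ (cong (ePrefix k) (stW-fromE E (l ∷ F)))
                  (cong₂ _++_ (cong (ePrefix l) (stW-fromE (k ∷ E) F)) (cong (ePrefix (k +ℕ l)) (stW-fromE E F))) ⟨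
  ePrefix k (stW (fromE E) (fromE (l ∷ F))) ++ ePrefix l (stW (fromE (k ∷ E)) (fromE F))
    ++ ePrefix (k +ℕ l) (stW (fromE E) (fromE F))  ∎
  where open ≡-Reasoning

pre-a-stW-fromE-∷ : ∀ k l E F → pre a (stW (fromE (k ∷ E)) (fromE (l ∷ F))) ≡
                    ePrefix (suc k) (stW (fromE E) (fromE (l ∷ F))) ++ pre a (ePrefix l (stW (fromE (k ∷ E)) (fromE F)))
                      ++ ePrefix (suc (k +ℕ l)) (stW (fromE E) (fromE F))
pre-a-stW-fromE-∷ k l E F = trans (cong (pre a) (stW-fromE-∷ k l E F))
  (map-++₃ _ (ePrefix k (stW (fromE E) (fromE (l ∷ F)))) (ePrefix l (stW (fromE (k ∷ E)) (fromE F)))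
             (ePrefix (k +ℕ l) (stW (fromE E) (fromE F))))

_⊙_ : Letter → Letter → Term
a ⊙ a = (-ℚ 1ℚ , 0ℤ , a ∷ a ∷ [])
a ⊙ b = (-ℚ 1ℚ , 0ℤ , a ∷ b ∷ [])
b ⊙ a = (-ℚ 1ℚ , 0ℤ , a ∷ b ∷ [])
b ⊙ b = (1ℚ , 0ℤ , b ∷ [])

pre-· : ∀ x L → pre x L ≡ (1ℚ , 0ℤ , [ x ]) · L
pre-· x [] = refl
pre-· x ((q , m , w) ∷ L) =
  cong₂ _∷_ (cong₂ (λ p n → p , n , x ∷ w) (sym (ℚ.*-identityˡ q)) (sym (ℤ.+-identityˡ m))) (pre-· x L)

aa-· : ∀ L → (a ⊙ a) · L ≡ neg (pre a (pre a L))
aa-· L = trans (List.map-∘ L) (List.map-∘ (map _ L))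

stW-∷ : ∀ x y u v → InĤ¹ (x ∷ u) → InĤ¹ (y ∷ v) →
        stW (x ∷ u) (y ∷ v) ≋ pre x (stW u (y ∷ v)) ++ pre y (stW (x ∷ u) v) ++ (x ⊙ y) · stW u v
stW-∷ .b .b .(fromE E) .(fromE F) (zero ∷ E , refl) (zero ∷ F , refl) = ≡⇒≋ (begin
  stW (fromE (0 ∷ E)) (fromE (0 ∷ F))
    ≡⟨ stW-fromE-∷ 0 0 E F ⟩
  pre b X ++ pre b Y ++ pre b Z
    ≡⟨ cong (λ S → pre b X ++ pre b Y ++ S) (pre-· b Z) ⟩
  pre b X ++ pre b Y ++ (b ⊙ b) · Z  ∎)
  where
  open ≡-Reasoning
  X = stW (fromE E) (fromE (0 ∷ F))
  Y = stW (fromE (0 ∷ E)) (fromE F)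
  Z = stW (fromE E) (fromE F)
stW-∷ .a .b .(fromE (k ∷ E)) .(fromE F) (suc k ∷ E , refl) (zero ∷ F , refl) = begin
  stW (fromE (suc k ∷ E)) (fromE (0 ∷ F))      ≡⟨ stW-fromE-∷ (suc k) 0 E F ⟩
  A ++ B ++ C                                  ≈⟨ ++-neg-cancelʳ (A ++ B ++ C) P ⟨
  ((A ++ B ++ C) ++ P) ++ neg P                ≈⟨ solve 5 (λ A B C P N → ((A ⊕ B ⊕ C) ⊕ P) ⊕ N ⊜ (A ⊕ P ⊕ C) ⊕ B ⊕ N)
                                                        ≋-refl A B C P (neg P) ⟩
  (A ++ P ++ C) ++ B ++ neg P                  ≡⟨ cong₂ (λ S T → S ++ B ++ T)
                                                        (pre-a-stW-fromE-∷ k 0 E F)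
                                                        (sym (diamond-· a b W)) ⟨
  pre a (stW (fromE (k ∷ E)) (fromE (0 ∷ F))) ++ B ++ (a ⊙ b) · W  ∎
  where
  open ≋-Reasoning
  W = stW (fromE (k ∷ E)) (fromE F)
  Z = stW (fromE E) (fromE F)
  A = ePrefix (suc k) (stW (fromE E) (fromE (0 ∷ F)))
  B = pre b (stW (fromE (suc k ∷ E)) (fromE F))
  C = ePrefix (suc (k +ℕ 0)) Z
  P = pre a (pre b W)
stW-∷ .b .a .(fromE E) .(fromE (l ∷ F)) (zero ∷ E , refl) (suc l ∷ F , refl) = begin
  stW (fromE (0 ∷ E)) (fromE (suc l ∷ F))      ≡⟨ stW-fromE-∷ 0 (suc l) E F ⟩
  A ++ B ++ C                                  ≈⟨ ++-neg-cancelʳ (A ++ B ++ C) P ⟨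
  ((A ++ B ++ C) ++ P) ++ neg P                ≈⟨ solve 5 (λ A B C P N → ((A ⊕ B ⊕ C) ⊕ P) ⊕ N ⊜ A ⊕ (P ⊕ B ⊕ C) ⊕ N)
                                                        ≋-refl A B C P (neg P) ⟩
  A ++ (P ++ B ++ C) ++ neg P                  ≡⟨ cong₂ (λ S T → A ++ S ++ T) (pre-a-stW-fromE-∷ 0 l E F)
                                                        (sym (diamond-· b a W)) ⟨
  A ++ pre a (stW (fromE (0 ∷ E)) (fromE (l ∷ F))) ++ (b ⊙ a) · W  ∎
  where
  open ≋-Reasoning
  W = stW (fromE E) (fromE (l ∷ F))
  A = pre b (stW (fromE E) (fromE (suc l ∷ F)))
  B = ePrefix (suc l) (stW (fromE (0 ∷ E)) (fromE F))
  C = ePrefix (suc l) (stW (fromE E) (fromE F))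
  P = pre a (pre b W)
stW-∷ .a .a .(fromE (k ∷ E)) .(fromE (l ∷ F)) (suc k ∷ E , refl) (suc l ∷ F , refl) = begin
  stW (fromE (suc k ∷ E)) (fromE (suc l ∷ F))
    ≡⟨ stW-fromE-∷ (suc k) (suc l) E F ⟩
  A ++ B ++ pre a (ePrefix (k +ℕ suc l) Z)
    ≡⟨ cong (λ j → A ++ B ++ pre a (ePrefix j Z)) (ℕ.+-suc k l) ⟩
  A ++ B ++ P₃
    ≈⟨ ++-neg-cancelʳ (A ++ B ++ P₃) (P₂ ++ P₁ ++ P₃) ⟨
  ((A ++ B ++ P₃) ++ (P₂ ++ P₁ ++ P₃)) ++ neg (P₂ ++ P₁ ++ P₃)
    ≈⟨ solve 6 (λ A B P₁ P₂ P₃ N → ((A ⊕ B ⊕ P₃) ⊕ (P₂ ⊕ P₁ ⊕ P₃)) ⊕ N ⊜ (A ⊕ P₁ ⊕ P₃) ⊕ (P₂ ⊕ B ⊕ P₃) ⊕ N)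
               ≋-refl A B P₁ P₂ P₃ (neg (P₂ ++ P₁ ++ P₃)) ⟩
  (A ++ P₁ ++ P₃) ++ (P₂ ++ B ++ P₃) ++ neg (P₂ ++ P₁ ++ P₃)
    ≡⟨ cong₂ _++_ first (cong₂ _++_ (pre-a-stW-fromE-∷ (suc k) l E F) third) ⟨
  pre a (stW (fromE (k ∷ E)) (fromE (suc l ∷ F))) ++ pre a (stW (fromE (suc k ∷ E)) (fromE (l ∷ F))) ++ (a ⊙ a) · W  ∎
  where
  open ≋-Reasoning
  W = stW (fromE (k ∷ E)) (fromE (l ∷ F))
  U = stW (fromE E) (fromE (l ∷ F))
  V = stW (fromE (k ∷ E)) (fromE F)
  Z = stW (fromE E) (fromE F)
  A = ePrefix (suc k) (stW (fromE E) (fromE (suc l ∷ F)))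
  B = ePrefix (suc l) (stW (fromE (suc k ∷ E)) (fromE F))
  P₁ = pre a (pre a (ePrefix l V))
  P₂ = pre a (pre a (ePrefix k U))
  P₃ = pre a (pre a (ePrefix (k +ℕ l) Z))
  first : pre a (stW (fromE (k ∷ E)) (fromE (suc l ∷ F))) ≡ A ++ P₁ ++ P₃
  first = trans (pre-a-stW-fromE-∷ k (suc l) E F) (cong (λ j → A ++ P₁ ++ pre a (ePrefix j Z)) (ℕ.+-suc k l))
  third : (a ⊙ a) · W ≡ neg (P₂ ++ P₁ ++ P₃)
  third = trans (aa-· W) (cong neg (trans (cong (pre a) (pre-a-stW-fromE-∷ k l E F))
                                          (map-++₃ _ (ePrefix (suc k) U) (pre a (ePrefix l V)) (ePrefix (suc (k +ℕ l)) Z))))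
stW-∷ _ _ _ _ ([] , ()) _
stW-∷ _ _ _ _ (_ ∷ _ , _) ([] , ())

σ-pre : ∀ x L → σ (pre x L) ≡ post (swap x) (shift (weight x) (σ L))
σ-pre x [] = refl
σ-pre x ((q , m , w) ∷ L) =
  cong₂ _∷_ (cong (λ n → q , n , mirror w ∷ʳ swap x) (exponent-moves m (exponent w) (weight x))) (σ-pre x L)
  where
  exponent-moves : ∀ m e k → m +ℤ (e +ℤ k) ≡ k +ℤ (m +ℤ e)
  exponent-moves = solve-∀

mirror-++ : ∀ u w → mirror (u ++ w) ≡ mirror w ++ mirror u
mirror-++ [] w = sym (List.++-identityʳ (mirror w))
mirror-++ (y ∷ u) w = trans (cong (_∷ʳ swap y) (mirror-++ u w)) (List.++-assoc (mirror w) (mirror u) [ swap y ])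

exponent-++ : ∀ u w → exponent (u ++ w) ≡ exponent u +ℤ exponent w
exponent-++ [] w = sym (ℤ.+-identityˡ (exponent w))
exponent-++ (y ∷ u) w = trans (cong (_+ℤ weight y) (exponent-++ u w)) (rearrange (exponent u) (exponent w) (weight y))
  where
  rearrange : ∀ i j k → (i +ℤ j) +ℤ k ≡ (i +ℤ k) +ℤ j
  rearrange = solve-∀

σ-· : ∀ s L → σ (s · L) ≡ σ L ·ʳ σTerm s
σ-· s [] = refl
σ-· s@(c , k , P) ((q , m , w) ∷ L) =
  cong₂ _∷_ (cong₂ (λ n u → c *ℚ q , n , u)
                   (trans (cong (k +ℤ m +ℤ_) (exponent-++ P w)) (ℤ-+-interchange k m (exponent P) (exponent w))) (mirror-++ P w))
            (σ-· s L)

shiftTerm : ℤ → Term → Term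
shiftTerm j (c , k , S) = (c , j +ℤ k , S)

σTerm-⊙ : ∀ x y → σTerm (x ⊙ y) ≡ shiftTerm (weight x +ℤ weight y) (swap x ⋄ swap y)
σTerm-⊙ a a = refl
σTerm-⊙ a b = refl
σTerm-⊙ b a = refl
σTerm-⊙ b b = refl

·ʳ-shiftTerm : ∀ j t L → L ·ʳ shiftTerm j t ≡ shift j L ·ʳ t
·ʳ-shiftTerm j t [] = refl
·ʳ-shiftTerm j t@(c , k , S) ((q , m , w) ∷ L) =
  cong₂ _∷_ (cong (λ n → c *ℚ q , n , w ++ S) (trans (ℤ.+-assoc j k m) (ℤ-+-leftComm j k m))) (·ʳ-shiftTerm j t L)

σ-⊙ : ∀ x y L → σ ((x ⊙ y) · L) ≡ diamondʳ (swap x) (swap y) (shift (weight x +ℤ weight y) (σ L))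
σ-⊙ x y L = begin
  σ ((x ⊙ y) · L)                                           ≡⟨ σ-· (x ⊙ y) L ⟩
  σ L ·ʳ σTerm (x ⊙ y)                                      ≡⟨ cong (σ L ·ʳ_) (σTerm-⊙ x y) ⟩
  σ L ·ʳ shiftTerm (weight x +ℤ weight y) (swap x ⋄ swap y)  ≡⟨ ·ʳ-shiftTerm (weight x +ℤ weight y) (swap x ⋄ swap y) (σ L) ⟩
  shift (weight x +ℤ weight y) (σ L) ·ʳ (swap x ⋄ swap y)    ∎
  where open ≡-Reasoning

shift-post : ∀ k x L → shift k (post x L) ≡ post x (shift k L)
shift-post k x [] = refl
shift-post k x (_ ∷ L) = cong (_ ∷_) (shift-post k x L)

shift-·ʳ : ∀ j t L → shift j (L ·ʳ t) ≡ shift j L ·ʳ t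
shift-·ʳ j t [] = refl
shift-·ʳ j t@(c , k , S) ((q , m , w) ∷ L) =
  cong₂ _∷_ (cong (λ n → c *ℚ q , n , w ++ S) (ℤ-+-leftComm j k m)) (shift-·ʳ j t L)

shift-shift : ∀ j k L → shift j (shift k L) ≡ shift (j +ℤ k) L
shift-shift j k [] = refl
shift-shift j k ((q , m , w) ∷ L) = cong₂ _∷_ (cong (λ n → q , n , w) (sym (ℤ.+-assoc j k m))) (shift-shift j k L)

shift-σ-pre-swap : ∀ k {j} x L → k -ℤ weight x ≡ j → shift k (σ (pre (swap x) L)) ≡ post x (shift j (σ L))
shift-σ-pre-swap k {j} x L k-x≡j = begin
  shift k (σ (pre (swap x) L))                                   ≡⟨ cong (shift k) (σ-pre (swap x) L) ⟩
  shift k (post (swap (swap x)) (shift (weight (swap x)) (σ L)))  ≡⟨ shift-post k (swap (swap x)) _ ⟩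
  post (swap (swap x)) (shift k (shift (weight (swap x)) (σ L)))  ≡⟨ cong₂ post (swap-involutive x) (shift-shift k _ (σ L)) ⟩
  post x (shift (k +ℤ weight (swap x)) (σ L))                     ≡⟨ cong (λ n → post x (shift n (σ L))) exponent≡j ⟩
  post x (shift j (σ L))                                          ∎
  where
  open ≡-Reasoning
  exponent≡j : k +ℤ weight (swap x) ≡ j
  exponent≡j = trans (cong (k +ℤ_) (weight-swap x)) k-x≡j

shift-σ-⊙-swap : ∀ k {j} x y L → (k -ℤ weight x) -ℤ weight y ≡ j →
                 shift k (σ ((swap x ⊙ swap y) · L)) ≡ diamondʳ x y (shift j (σ L))
shift-σ-⊙-swap k {j} x y L k-x-y≡j = begin
  shift k (σ ((swap x ⊙ swap y) · L))
    ≡⟨ cong (shift k) (σ-⊙ (swap x) (swap y) L) ⟩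
  shift k (shift (weight (swap x) +ℤ weight (swap y)) (σ L) ·ʳ (swap (swap x) ⋄ swap (swap y)))
    ≡⟨ shift-·ʳ k (swap (swap x) ⋄ swap (swap y)) _ ⟩
  shift k (shift (weight (swap x) +ℤ weight (swap y)) (σ L)) ·ʳ (swap (swap x) ⋄ swap (swap y))
    ≡⟨ cong₂ _·ʳ_ (shift-shift k _ (σ L)) (cong₂ _⋄_ (swap-involutive x) (swap-involutive y)) ⟩
  shift (k +ℤ (weight (swap x) +ℤ weight (swap y))) (σ L) ·ʳ (x ⋄ y)
    ≡⟨ cong (λ n → shift n (σ L) ·ʳ (x ⋄ y)) exponent≡j ⟩
  shift j (σ L) ·ʳ (x ⋄ y)  ∎
  where
  open ≡-Reasoning
  regroup : ∀ k p r → k +ℤ (-ℤ p +ℤ -ℤ r) ≡ (k -ℤ p) -ℤ r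
  regroup = solve-∀
  exponent≡j : k +ℤ (weight (swap x) +ℤ weight (swap y)) ≡ j
  exponent≡j = trans (cong (λ n → k +ℤ n) (cong₂ _+ℤ_ (weight-swap x) (weight-swap y)))
                     (trans (regroup k (weight x) (weight y)) k-x-y≡j)

σ-stW-∷ : ∀ α β u v k l → InĤ¹ (swap α ∷ u) → InĤ¹ (swap β ∷ v) →
          shift ((k +ℤ weight α) +ℤ (l +ℤ weight β)) (σ (stW (swap α ∷ u) (swap β ∷ v))) ≋
          shuffleʳ α β (shift (k +ℤ (l +ℤ weight β)) (σ (stW u (swap β ∷ v))))
                       (shift ((k +ℤ weight α) +ℤ l) (σ (stW (swap α ∷ u) v)))
                       (shift (k +ℤ l) (σ (stW u v)))
σ-stW-∷ α β u v k l αu∈Ĥ¹ βv∈Ĥ¹ = begin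
  shift K (σ (stW (swap α ∷ u) (swap β ∷ v)))
    ≈⟨ shift-cong K (σ-cong (stW-∷ (swap α) (swap β) u v αu∈Ĥ¹ βv∈Ĥ¹)) ⟩
  shift K (σ (pre (swap α) A ++ pre (swap β) B ++ (swap α ⊙ swap β) · C))
    ≡⟨ cong (shift K) (map-++₃ _ (pre (swap α) A) (pre (swap β) B) ((swap α ⊙ swap β) · C)) ⟩
  shift K (σ (pre (swap α) A) ++ σ (pre (swap β) B) ++ σ ((swap α ⊙ swap β) · C))
    ≡⟨ map-++₃ _ (σ (pre (swap α) A)) (σ (pre (swap β) B)) (σ ((swap α ⊙ swap β) · C)) ⟩
  shift K (σ (pre (swap α) A)) ++ shift K (σ (pre (swap β) B)) ++ shift K (σ ((swap α ⊙ swap β) · C))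
    ≡⟨ cong₂ _++_ (shift-σ-pre-swap K α A (drop-α k l (weight α) (weight β)))
                  (cong₂ _++_ (shift-σ-pre-swap K β B (drop-β k l (weight α) (weight β)))
                              (shift-σ-⊙-swap K α β C (drop-αβ k l (weight α) (weight β)))) ⟩
  shuffleʳ α β (shift (k +ℤ (l +ℤ weight β)) (σ A)) (shift ((k +ℤ weight α) +ℤ l) (σ B)) (shift (k +ℤ l) (σ C))  ∎
  where
  open ≋-Reasoning
  K = (k +ℤ weight α) +ℤ (l +ℤ weight β)
  A = stW u (swap β ∷ v)
  B = stW (swap α ∷ u) v
  C = stW u v
  drop-α : ∀ k l p r → ((k +ℤ p) +ℤ (l +ℤ r)) -ℤ p ≡ k +ℤ (l +ℤ r)
  drop-α = solve-∀
  drop-β : ∀ k l p r → ((k +ℤ p) +ℤ (l +ℤ r)) -ℤ r ≡ (k +ℤ p) +ℤ l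
  drop-β = solve-∀
  drop-αβ : ∀ k l p r → (((k +ℤ p) +ℤ (l +ℤ r)) -ℤ p) -ℤ r ≡ k +ℤ l
  drop-αβ = solve-∀

-- σ (σ w ∗_q σ v) for single words w and v.
σ-stuffle : Word → Word → Lin
σ-stuffle w v = shift (exponent w +ℤ exponent v) (σ (stW (mirror w) (mirror v)))

σ-stuffle-∷ʳ : ∀ α β w v → InĤ¹ (mirror (w ∷ʳ α)) → InĤ¹ (mirror (v ∷ʳ β)) →
               σ-stuffle (w ∷ʳ α) (v ∷ʳ β) ≋
               shuffleʳ α β (σ-stuffle w (v ∷ʳ β)) (σ-stuffle (w ∷ʳ α) v) (σ-stuffle w v)
σ-stuffle-∷ʳ α β w v wα∈Ĥ¹ vβ∈Ĥ¹
  rewrite exponent-∷ʳ w α | exponent-∷ʳ v β | mirror-∷ʳ w α | mirror-∷ʳ v β =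
  σ-stW-∷ α β (mirror w) (mirror v) (exponent w) (exponent v) wα∈Ĥ¹ vβ∈Ĥ¹

stW-[]ˡ : ∀ u → InĤ¹ u → stW [] u ≡ ⟦ u ⟧
stW-[]ˡ .(fromE E) (E , refl) = stW-fromE [] E

stW-[]ʳ : ∀ u → InĤ¹ u → stW u [] ≡ ⟦ u ⟧
stW-[]ʳ .(fromE []) ([] , refl) = refl
stW-[]ʳ .(fromE (k ∷ E)) (k ∷ E , refl) = stW-fromE (k ∷ E) []

shift-σ-⟦mirror⟧ : ∀ {k} u → k ≡ exponent u → shift k (σ ⟦ mirror u ⟧) ≡ ⟦ u ⟧
shift-σ-⟦mirror⟧ {k} u k≡u = cong [_] (cong₂ (λ n w → 1ℚ , n , w) exponent≡0 (mirror-involutive u))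
  where
  cancel : ∀ e → e +ℤ (0ℤ +ℤ -ℤ e) ≡ 0ℤ
  cancel = solve-∀
  exponent≡0 : k +ℤ (0ℤ +ℤ exponent (mirror u)) ≡ 0ℤ
  exponent≡0 = trans (cong₂ (λ i j → i +ℤ (0ℤ +ℤ j)) k≡u (exponent-mirror u)) (cancel (exponent u))

shW≡σ-stuffle-[]ˡ : ∀ v → InĤ¹ (mirror v) → shW [] v ≡ σ-stuffle [] v
shW≡σ-stuffle-[]ˡ v v∈Ĥ¹ = sym (begin
  shift (0ℤ +ℤ exponent v) (σ (stW [] (mirror v)))   ≡⟨ cong (shift (0ℤ +ℤ exponent v) ∘ σ) (stW-[]ˡ (mirror v) v∈Ĥ¹) ⟩
  shift (0ℤ +ℤ exponent v) (σ ⟦ mirror v ⟧)         ≡⟨ shift-σ-⟦mirror⟧ v (ℤ.+-identityˡ (exponent v)) ⟩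
  ⟦ v ⟧                                            ∎)
  where open ≡-Reasoning

shW≡σ-stuffle-[]ʳ : ∀ w → InĤ¹ (mirror w) → shW w [] ≡ σ-stuffle w []
shW≡σ-stuffle-[]ʳ w w∈Ĥ¹ = sym (begin
  shift (exponent w +ℤ 0ℤ) (σ (stW (mirror w) []))   ≡⟨ cong (shift (exponent w +ℤ 0ℤ) ∘ σ) (stW-[]ʳ (mirror w) w∈Ĥ¹) ⟩
  shift (exponent w +ℤ 0ℤ) (σ ⟦ mirror w ⟧)         ≡⟨ shift-σ-⟦mirror⟧ w (ℤ.+-identityʳ (exponent w)) ⟩
  ⟦ w ⟧                                            ≡⟨ shW-[]ʳ w ⟨
  shW w []                                         ∎)
  where open ≡-Reasoning

InC+aĤ : Word → Set
InC+aĤ w = w ≡ [] ⊎ ∃ λ u → w ≡ a ∷ u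

InC+aĤ-∷ʳ⁻ : ∀ w α → InC+aĤ (w ∷ʳ α) → InC+aĤ w
InC+aĤ-∷ʳ⁻ [] α _ = inj₁ refl
InC+aĤ-∷ʳ⁻ (x ∷ w) α (inj₂ (_ , refl)) = inj₂ (w , refl)

∷ʳb-fromE : ∀ u → ∃₂ λ k E → fromE (k ∷ E) ≡ u ∷ʳ b
∷ʳb-fromE [] = 0 , [] , refl
∷ʳb-fromE (a ∷ u) with ∷ʳb-fromE u
... | k , E , eq = suc k , E , cong (a ∷_) eq
∷ʳb-fromE (b ∷ u) with ∷ʳb-fromE u
... | k , E , eq = 0 , k ∷ E , cong (b ∷_) eq

mirror-InĤ¹ : ∀ w → InC+aĤ w → InĤ¹ (mirror w)
mirror-InĤ¹ .[] (inj₁ refl) = [] , refl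
mirror-InĤ¹ .(a ∷ u) (inj₂ (u , refl)) with ∷ʳb-fromE (mirror u)
... | k , E , eq = k ∷ E , eq

shW≋σ-stuffle : ∀ {w v} → Reverse w → Reverse v → InC+aĤ w → InC+aĤ v → shW w v ≋ σ-stuffle w v
shW≋σ-stuffle {v = v} [] _ _ v∈C+aĤ = ≡⇒≋ (shW≡σ-stuffle-[]ˡ v (mirror-InĤ¹ v v∈C+aĤ))
shW≋σ-stuffle {w = w} (_ ∶ _ ∶ʳ _) [] w∈C+aĤ _ = ≡⇒≋ (shW≡σ-stuffle-[]ʳ w (mirror-InĤ¹ w w∈C+aĤ))
shW≋σ-stuffle (w ∶ rw ∶ʳ α) (v ∶ rv ∶ʳ β) wα∈C+aĤ vβ∈C+aĤ = begin
  shW (w ∷ʳ α) (v ∷ʳ β)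
    ≈⟨ shW-∷ʳ α β w v ⟩
  shuffleʳ α β (shW w (v ∷ʳ β)) (shW (w ∷ʳ α) v) (shW w v)
    ≈⟨ shuffleʳ-cong α β (shW≋σ-stuffle rw (v ∶ rv ∶ʳ β) w∈C+aĤ vβ∈C+aĤ)
                         (shW≋σ-stuffle (w ∶ rw ∶ʳ α) rv wα∈C+aĤ v∈C+aĤ)
                         (shW≋σ-stuffle rw rv w∈C+aĤ v∈C+aĤ) ⟩
  shuffleʳ α β (σ-stuffle w (v ∷ʳ β)) (σ-stuffle (w ∷ʳ α) v) (σ-stuffle w v)
    ≈⟨ σ-stuffle-∷ʳ α β w v (mirror-InĤ¹ (w ∷ʳ α) wα∈C+aĤ) (mirror-InĤ¹ (v ∷ʳ β) vβ∈C+aĤ) ⟨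
  σ-stuffle (w ∷ʳ α) (v ∷ʳ β)  ∎
  where
  open ≋-Reasoning
  w∈C+aĤ = InC+aĤ-∷ʳ⁻ w α wα∈C+aĤ
  v∈C+aĤ = InC+aĤ-∷ʳ⁻ v β vβ∈C+aĤ

σ-scale : ∀ c k L → σ (scale c k L) ≡ scale c k (σ L)
σ-scale c k [] = refl
σ-scale c k ((q , m , w) ∷ L) = cong₂ _∷_ (cong (λ n → c *ℚ q , n , mirror w) (ℤ.+-assoc k m (exponent w))) (σ-scale c k L)

scale-shift : ∀ c k j L → scale c k (shift j L) ≡ scale c (k +ℤ j) L
scale-shift c k j [] = refl
scale-shift c k j ((q , m , w) ∷ L) = cong₂ _∷_ (cong (λ n → c *ℚ q , n , w) (sym (ℤ.+-assoc k j m))) (scale-shift c k j L)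

termProduct : (Word → Word → Lin) → Term → Term → Lin
termProduct f (q , m , w) (q′ , m′ , v) = scale (q *ℚ q′) (m +ℤ m′) (f w v)

InH0W⇒InC+aĤ : ∀ {w} → InH0W w → InC+aĤ w
InH0W⇒InC+aĤ (inj₁ w≡[]) = inj₁ w≡[]
InH0W⇒InC+aĤ (inj₂ (u , w≡aub)) = inj₂ (u ++ [ b ] , w≡aub)

termProduct-shW : ∀ q m w q′ m′ v → InH0W w → InH0W v →
                  termProduct shW (q , m , w) (q′ , m′ , v) ≋ σ (termProduct stW (σTerm (q , m , w)) (σTerm (q′ , m′ , v)))
termProduct-shW q m w q′ m′ v w∈H⁰ v∈H⁰ = begin
  scale c (m +ℤ m′) (shW w v)
    ≈⟨ scale-cong c (m +ℤ m′) (shW≋σ-stuffle (reverseView w) (reverseView v) (InH0W⇒InC+aĤ w∈H⁰) (InH0W⇒InC+aĤ v∈H⁰)) ⟩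
  scale c (m +ℤ m′) (shift (exponent w +ℤ exponent v) (σ S))
    ≡⟨ scale-shift c (m +ℤ m′) (exponent w +ℤ exponent v) (σ S) ⟩
  scale c ((m +ℤ m′) +ℤ (exponent w +ℤ exponent v)) (σ S)
    ≡⟨ cong (λ n → scale c n (σ S)) (ℤ-+-interchange m m′ (exponent w) (exponent v)) ⟩
  scale c ((m +ℤ exponent w) +ℤ (m′ +ℤ exponent v)) (σ S)
    ≡⟨ σ-scale c ((m +ℤ exponent w) +ℤ (m′ +ℤ exponent v)) S ⟨
  σ (scale c ((m +ℤ exponent w) +ℤ (m′ +ℤ exponent v)) S)  ∎
  where
  open ≋-Reasoning
  c = q *ℚ q′
  S = stW (mirror w) (mirror v)

concatMap-cong : ∀ {P : Term → Set} {f g : Term → Lin} L → All P L → (∀ {t} → P t → f t ≋ g t) →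
                 concatMap f L ≋ concatMap g L
concatMap-cong [] [] f≋g = ≋-refl
concatMap-cong (t ∷ L) (Pt ∷ PL) f≋g = ++-cong (f≋g Pt) (concatMap-cong L PL f≋g)

σ-bilinear-σ : ∀ f L M → σ (bilinear f (σ L) (σ M)) ≡
               concatMap (λ t → concatMap (λ t′ → σ (termProduct f (σTerm t) (σTerm t′))) M) L
σ-bilinear-σ f L M = begin
  σ (concatMap (λ t → concatMap (termProduct f t) (σ M)) (σ L))
    ≡⟨ List.map-concatMap σTerm _ (σ L) ⟩
  concatMap (λ t → σ (concatMap (termProduct f t) (σ M))) (σ L)
    ≡⟨ List.concatMap-map _ σTerm L ⟩
  concatMap (λ t → σ (concatMap (termProduct f (σTerm t)) (σ M))) L
    ≡⟨ List.concatMap-cong (λ t → trans (List.map-concatMap σTerm _ (σ M)) (List.concatMap-map _ σTerm M)) L ⟩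
  concatMap (λ t → concatMap (λ t′ → σ (termProduct f (σTerm t) (σTerm t′))) M) L  ∎
  where open ≡-Reasoning

corollary3p22 : (w v : Lin) → InH0 w → InH0 v → w ⧢q v ≈ σ (σ w ∗q σ v)
corollary3p22 w v w∈H⁰ v∈H⁰ = ≋⇒≈ (begin
  concatMap (λ t → concatMap (termProduct shW t) v) w
    ≈⟨ concatMap-cong w w∈H⁰ (λ {(q , m , x)} x∈H⁰ → concatMap-cong v v∈H⁰ (λ {(q′ , m′ , y)} y∈H⁰ →
         termProduct-shW q m x q′ m′ y x∈H⁰ y∈H⁰)) ⟩
  concatMap (λ t → concatMap (λ t′ → σ (termProduct stW (σTerm t) (σTerm t′))) v) w
    ≡⟨ σ-bilinear-σ stW w v ⟨
  σ (σ w ∗q σ v)  ∎)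
  where open ≋-Reasoning
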